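{- Let $\xi$ be a recurrent bi-infinite word. The following are equivalent: (1) $\xi$ is periodic; (2) $F(\xi)$ contains a determining word; (3) $F(\xi)$ contains a right-determining word; (3') $F(\xi)$ contains a left-determining word.
   Context: A bi-infinite word is a map $\xi\colon\mathbb Z\to\{0,1\}$; $F(\xi)$ is the set of its factors $\xi(i)\xi(i+1)\cdots\xi(j)$ ($i\le j$) together with the empty word. $\xi$ is recurrent if $F(\xi)=F(\xi(-\infty,i])=F(\xi[i,\infty))$ for all $i\in\mathbb Z$ (factor sets of the left- and right-infinite halves defined analogously). $\xi$ is periodic if there is $p>0$ with $\xi(n)=\xi(n+p)$ for all $n\in\mathbb Z$. For a language $L\subseteq\{0,1\}^*$, a word $u\in L$ is left-determining in $L$ if for every $k\in\mathbb N$ there is exactly one word $vu\in L$ with $|v|=k$; right-determining in $L$ if for every $k\in\mathbb N$ there is exactly one word $uv\in L$ with $|v|=k$; and determining in $L$ if it is both. -}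

module Defs where

open import Data.Bool using (Bool)
open import Data.Nat using (ℕ; _<_)
open import Data.Integer using (ℤ; +_; _+_; _-_; _≤_)
open import Data.List using (List; []; length; _++_; lookup)
open import Data.Fin using (Fin; toℕ)
open import Data.Product using (Σ; ∃; _×_; _,_)
open import Relation.Binary.PropositionalEquality using (_≡_)
open import Data.Unit using (⊤)

BiWord : Set
BiWord = ℤ → Bool

-- A language over {0,1} (Bool encodes the alphabet) as a predicate on words.
Language : Set₁
Language = List Bool → Set

OccursAt : BiWord → ℤ → List Bool → Set
OccursAt ξ i u = (k : Fin (length u)) → lookup u k ≡ ξ (i + + toℕ k)

-- F(ξ): all finite factors of ξ, including the empty word (which occurs everywhere).
F : BiWord → Language
F ξ u = ∃ λ i → OccursAt ξ i u

FLeft : BiWord → ℤ → Language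
FLeft ξ j [] = ⊤
FLeft ξ j u = ∃ λ i → (i + + length u - + 1 ≤ j) × OccursAt ξ i u

FRight : BiWord → ℤ → Language
FRight ξ j u = ∃ λ i → (j ≤ i) × OccursAt ξ i u

_≐_ : Language → Language → Set
L ≐ M = ((u : List Bool) → L u → M u) × ((u : List Bool) → M u → L u)

Recurrent : BiWord → Set
Recurrent ξ = (i : ℤ) → (F ξ ≐ FLeft ξ i) × (F ξ ≐ FRight ξ i)

Periodic : BiWord → Set
Periodic ξ = Σ ℕ λ p → (0 < p) × ((n : ℤ) → ξ n ≡ ξ (n + + p))

ExactlyOneOfLength : ℕ → (List Bool → Set) → Set
ExactlyOneOfLength k P =
  Σ (List Bool) λ v → (length v ≡ k) × P v
    × ((w : List Bool) → length w ≡ k → P w → w ≡ v)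

LeftDetermining : Language → List Bool → Set
LeftDetermining L u = L u × ((k : ℕ) → ExactlyOneOfLength k (λ v → L (v ++ u)))

RightDetermining : Language → List Bool → Set
RightDetermining L u = L u × ((k : ℕ) → ExactlyOneOfLength k (λ v → L (u ++ v)))

Determining : Language → List Bool → Set
Determining L u = LeftDetermining L u × RightDetermining L u

module Submission where

-- Periodic ⇒ determining: if p > 0 is a period, the window u of length p at
--   any position c pins ξ down: wherever u occurs, ξ looks as it does from c.
--   Hence every occurrence of u extends on either side exactly as at c.
-- Right-determining ⇒ periodic: let u occur at i.  Recurrence gives a second
--   occurrence at i + p with p > 0; uniqueness of the right extensions of u
--   then makes p a period of ξ on the region right of i + |u|.  By recurrence
--   every factor of length p + 1 reappears inside that region, so p is a
--   period of ξ everywhere.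
-- Left-determining ⇒ periodic is the mirror image (left extensions, region
--   left of i); determining ⇒ right/left-determining is a projection.

open import Defs
open import Data.Bool using (Bool)
open import Data.List using (List; []; _∷_; length; _++_)
open import Data.List.Properties using (∷-injective)
open import Data.Fin using (toℕ) renaming (zero to fzero; suc to fsuc)
open import Data.Product using (Σ; ∃; _×_; _,_; proj₁; proj₂; map₂)
open import Function using (_∘_)
open import Function.Bundles using (_⇔_; mk⇔)
open import Data.Nat as ℕ using (ℕ; zero; suc; s≤s; z≤n; NonZero)
import Data.Nat.Properties as ℕP
open import Data.Integer as ℤ using (ℤ; +_; -[1+_]; _+_; _-_; _*_; -_)
import Data.Integer.Properties as ℤP
open import Data.Integer.DivMod using (_%ℕ_; _/ℕ_; a≡a%ℕn+[a/ℕn]*n; n%ℕd<d)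
open import Data.Integer.Tactic.RingSolver using (solve-∀)
open import Relation.Binary.PropositionalEquality

≤⇒offset : ∀ {i j} → i ℤ.≤ j → Σ ℕ λ s → j ≡ i + + s
≤⇒offset {i} {j} i≤j with j - i in eq | ℤP.i≤j⇒0≤j-i i≤j
... | + s | _ = s , trans (difference i j) (cong (λ d → i + d) eq)
  where
  difference : ∀ i j → j ≡ i + (j - i)
  difference = solve-∀

<⇒offset : ∀ {i j} → i ℤ.< j → Σ ℕ λ t → j ≡ i + + suc t
<⇒offset {i} i<j with ≤⇒offset (ℤP.i<j⇒suc[i]≤j i<j)
... | t , eq = t , trans eq (regroup i (+ t))
  where
  regroup : ∀ i t → (+ 1 + i) + t ≡ i + (+ 1 + t)
  regroup = solve-∀

left-half-start : ∀ m L i → m + + suc L - + 1 ℤ.≤ i - + 1 → m ℤ.< i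
left-half-start m L i ends-before = ℤP.suc[i]≤j⇒i<j (begin
  + 1 + m                      ≤⟨ ℤP.i≤i+j (+ 1 + m) (+ L) ⟩
  (+ 1 + m) + + L              ≡⟨ regroup m (+ L) ⟩
  + 1 + (m + + suc L - + 1)    ≤⟨ ℤP.+-monoʳ-≤ (+ 1) ends-before ⟩
  + 1 + (i - + 1)              ≡⟨ cancel i ⟩
  i                            ∎)
  where
  open ℤP.≤-Reasoning
  regroup : ∀ m L → (+ 1 + m) + L ≡ + 1 + (m + (+ 1 + L) - + 1)
  regroup = solve-∀
  cancel : ∀ i → + 1 + (i - + 1) ≡ i
  cancel = solve-∀

module _ (ξ : BiWord) where

  window : ℤ → ℕ → List Bool
  window i zero    = []
  window i (suc k) = ξ i ∷ window (i + + 1) k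

  length-window : ∀ i k → length (window i k) ≡ k
  length-window i zero    = refl
  length-window i (suc k) = cong suc (length-window (i + + 1) k)

  next-position : ∀ i t → i + + suc t ≡ (i + + 1) + + t
  next-position i t = sym (ℤP.+-assoc i (+ 1) (+ t))

  occurs-subst : ∀ u {i j} → i ≡ j → OccursAt ξ i u → OccursAt ξ j u
  occurs-subst u = subst (λ i → OccursAt ξ i u)

  occurs-head : ∀ i x u → OccursAt ξ i (x ∷ u) → x ≡ ξ i
  occurs-head i x u o = trans (o fzero) (cong ξ (ℤP.+-identityʳ i))

  occurs-tail : ∀ i x u → OccursAt ξ i (x ∷ u) → OccursAt ξ (i + + 1) u
  occurs-tail i x u o t = trans (o (fsuc t)) (cong ξ (next-position i (toℕ t)))

  occurs-∷ : ∀ i x u → x ≡ ξ i → OccursAt ξ (i + + 1) u → OccursAt ξ i (x ∷ u)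
  occurs-∷ i x u x≡ o fzero    = trans x≡ (cong ξ (sym (ℤP.+-identityʳ i)))
  occurs-∷ i x u x≡ o (fsuc t) = trans (o t) (cong ξ (sym (next-position i (toℕ t))))

  window-occurs : ∀ i k → OccursAt ξ i (window i k)
  window-occurs i zero    ()
  window-occurs i (suc k) =
    occurs-∷ i (ξ i) (window (i + + 1) k) refl (window-occurs (i + + 1) k)

  occurs⇒window : ∀ i {k} w → length w ≡ k → OccursAt ξ i w → w ≡ window i k
  occurs⇒window i []      refl o = refl
  occurs⇒window i (x ∷ w) refl o =
    cong₂ _∷_ (occurs-head i x w o)
              (occurs⇒window (i + + 1) w refl (occurs-tail i x w o))

  window-reoccurs : ∀ i j k → OccursAt ξ i (window j k) → window j k ≡ window i k
  window-reoccurs i j k = occurs⇒window i (window j k) (length-window j k)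

  occurs-++ : ∀ i u w → OccursAt ξ i u → OccursAt ξ (i + + length u) w →
    OccursAt ξ i (u ++ w)
  occurs-++ i []      w oᵤ o_w = occurs-subst w (ℤP.+-identityʳ i) o_w
  occurs-++ i (x ∷ u) w oᵤ o_w = occurs-∷ i x (u ++ w) (occurs-head i x u oᵤ)
    (occurs-++ (i + + 1) u w (occurs-tail i x u oᵤ)
      (occurs-subst w (next-position i (length u)) o_w))

  occurs-++⁻ : ∀ i u w → OccursAt ξ i (u ++ w) →
    OccursAt ξ i u × OccursAt ξ (i + + length u) w
  occurs-++⁻ i []      w o = (λ ()) , occurs-subst w (sym (ℤP.+-identityʳ i)) o
  occurs-++⁻ i (x ∷ u) w o with occurs-++⁻ (i + + 1) u w (occurs-tail i x (u ++ w) o)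
  ... | oᵤ , o_w = occurs-∷ i x u (occurs-head i x (u ++ w) o) oᵤ
                 , occurs-subst w (sym (next-position i (length u))) o_w

  window-agree : ∀ a b k → window a k ≡ window b k →
    ∀ r → r ℕ.< k → ξ (a + + r) ≡ ξ (b + + r)
  window-agree a b (suc k) eq zero _ =
    trans (cong ξ (ℤP.+-identityʳ a))
      (trans (proj₁ (∷-injective eq)) (cong ξ (sym (ℤP.+-identityʳ b))))
  window-agree a b (suc k) eq (suc r) (s≤s r<k) =
    trans (cong ξ (next-position a r))
      (trans (window-agree (a + + 1) (b + + 1) k (proj₂ (∷-injective eq)) r r<k)
        (cong ξ (sym (next-position b r))))

HasPeriod : BiWord → ℕ → Set
HasPeriod ξ p = ∀ n → ξ n ≡ ξ (n + + p)

Agree : BiWord → ℤ → ℤ → Set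
Agree ξ c d = ∀ z → ξ (c + z) ≡ ξ (d + z)

agree-occurs : ∀ ξ c d → Agree ξ c d →
  ∀ x w → OccursAt ξ (c + x) w → OccursAt ξ (d + x) w
agree-occurs ξ c d same x w o t = trans (o t) (trans (cong ξ (ℤP.+-assoc c x _))
  (trans (same (x + _)) (cong ξ (sym (ℤP.+-assoc d x _)))))

period-natural-multiple : ∀ ξ {p} → HasPeriod ξ p →
  ∀ n t → ξ (n + + t * + p) ≡ ξ n
period-natural-multiple ξ {p} per n zero    = cong ξ (zero-multiple n (+ p))
  where
  zero-multiple : ∀ n p → n + + 0 * p ≡ n
  zero-multiple = solve-∀
period-natural-multiple ξ {p} per n (suc t) =
  trans (cong ξ (next-multiple n (+ t) (+ p)))
    (trans (sym (per _)) (period-natural-multiple ξ per n t))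
  where
  next-multiple : ∀ n t p → n + (+ 1 + t) * p ≡ (n + t * p) + p
  next-multiple = solve-∀

period-multiple : ∀ ξ {p} → HasPeriod ξ p → ∀ n q → ξ (n + q * + p) ≡ ξ n
period-multiple ξ per n (+ t)        = period-natural-multiple ξ per n t
period-multiple ξ {p} per n -[1+ t ] =
  trans (sym (period-natural-multiple ξ per (n + -[1+ t ] * + p) (suc t)))
    (cong ξ (sym (undo-multiple n (+ suc t) (+ p))))
  where
  undo-multiple : ∀ n t p → n ≡ (n + (- t) * p) + t * p
  undo-multiple = solve-∀

-- For a nonzero period p, equal windows of length p at c and d make ξ look
-- the same from c and from d: every position reduces modulo p into the window.
period-window-agree : ∀ ξ {p} .{{_ : NonZero p}} → HasPeriod ξ p →
  ∀ c d → window ξ c p ≡ window ξ d p → Agree ξ c d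
period-window-agree ξ {p} per c d same z = begin
  ξ (c + z)      ≡⟨ reduce c ⟩
  ξ (c + + r)    ≡⟨ window-agree ξ c d p same r (n%ℕd<d z p) ⟩
  ξ (d + + r)    ≡⟨ reduce d ⟨
  ξ (d + z)      ∎
  where
  open ≡-Reasoning
  r = z %ℕ p
  reduce : ∀ c → ξ (c + z) ≡ ξ (c + + r)
  reduce c = begin
    ξ (c + z)                        ≡⟨ cong (λ y → ξ (c + y)) (a≡a%ℕn+[a/ℕn]*n z p) ⟩
    ξ (c + (+ r + (z /ℕ p) * + p))   ≡⟨ cong ξ (ℤP.+-assoc c (+ r) _) ⟨
    ξ (c + + r + (z /ℕ p) * + p)     ≡⟨ period-multiple ξ per (c + + r) (z /ℕ p) ⟩
    ξ (c + + r)                      ∎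

-- For a nonzero period p, the window of length p at any position c is
-- determining: every occurrence of it sees ξ as from c, so it extends on
-- either side exactly as the occurrence at c does.
period⇒determining : ∀ ξ {p} .{{_ : NonZero p}} → HasPeriod ξ p →
  ∀ c → Determining (F ξ) (window ξ c p)
period⇒determining ξ {p} per c = (u∈F , left) , (u∈F , right)
  where
  u = window ξ c p
  L = length u

  u∈F : F ξ u
  u∈F = c , window-occurs ξ c p

  recentre : ∀ j → OccursAt ξ j u → Agree ξ j c
  recentre j o = period-window-agree ξ per j c (sym (window-reoccurs ξ j c p o))

  right : ∀ k → ExactlyOneOfLength k (λ v → F ξ (u ++ v))
  right k = window ξ (c + + L) k , length-window ξ _ k
          , (c , occurs-++ ξ c u (window ξ (c + + L) k) (window-occurs ξ c p)
                   (window-occurs ξ (c + + L) k))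
          , unique
    where
    unique : ∀ w → length w ≡ k → F ξ (u ++ w) → w ≡ window ξ (c + + L) k
    unique w |w|≡k (j , o) with occurs-++⁻ ξ j u w o
    ... | oᵤ , o_w =
      occurs⇒window ξ (c + + L) w |w|≡k
        (agree-occurs ξ j c (recentre j oᵤ) (+ L) w o_w)

  left : ∀ k → ExactlyOneOfLength k (λ v → F ξ (v ++ u))
  left k = window ξ (c - + k) k , length-window ξ _ k
         , (c - + k , occurs-++ ξ (c - + k) (window ξ (c - + k) k) u
                        (window-occurs ξ (c - + k) k)
                        (occurs-subst ξ u (back-to-c k) (window-occurs ξ c p)))
         , unique
    where
    back-to-c : ∀ k → c ≡ (c - + k) + + length (window ξ (c - + k) k)
    back-to-c k = trans (cancel c (+ k))
      (cong (λ m → (c - + k) + + m) (sym (length-window ξ (c - + k) k)))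
      where
      cancel : ∀ c k → c ≡ (c - k) + k
      cancel = solve-∀

    unique : ∀ w → length w ≡ k → F ξ (w ++ u) → w ≡ window ξ (c - + k) k
    unique w |w|≡k (j , o) with occurs-++⁻ ξ j w u o
    ... | o_w , oᵤ = trans
      (occurs⇒window ξ (c - + length w) w refl
        (agree-occurs ξ (j + + length w) c (recentre (j + + length w) oᵤ) (- + length w) w
          (occurs-subst ξ w (cancel j (+ length w)) o_w)))
      (cong (λ m → window ξ (c - + m) m) |w|≡k)
      where
      cancel : ∀ j m → j ≡ (j + m) + - m
      cancel = solve-∀

exactly-one-unique : ∀ {k P} → ExactlyOneOfLength k P →
  ∀ {w w′} → length w ≡ k → P w → length w′ ≡ k → P w′ → w ≡ w′
exactly-one-unique (_ , _ , _ , unique) |w| w∈P |w′| w′∈P =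
  trans (unique _ |w| w∈P) (sym (unique _ |w′| w′∈P))

region-period⇒period : ∀ ξ (S : ℤ → Set) p →
  (∀ n → S n → ξ n ≡ ξ (n + + p)) →
  (∀ n → ∃ λ m → S m × OccursAt ξ m (window ξ n (suc p))) →
  HasPeriod ξ p
region-period⇒period ξ S p period-on-S reoccurs n with reoccurs n
... | m , m∈S , o = begin
  ξ n            ≡⟨ cong ξ (ℤP.+-identityʳ n) ⟨
  ξ (n + + 0)    ≡⟨ letter 0 (s≤s z≤n) ⟩
  ξ (m + + 0)    ≡⟨ cong ξ (ℤP.+-identityʳ m) ⟩
  ξ m            ≡⟨ period-on-S m m∈S ⟩
  ξ (m + + p)    ≡⟨ letter p ℕP.≤-refl ⟨
  ξ (n + + p)    ∎
  where
  open ≡-Reasoning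
  letter : ∀ r → r ℕ.< suc p → ξ (n + + r) ≡ ξ (m + + r)
  letter = window-agree ξ n m (suc p) (window-reoccurs ξ m n (suc p) o)

-- Two occurrences, at i and i + p, of a right-determining factor u make p a
-- period of ξ on the region right of the first occurrence: both extend by the
-- same word of any length.
right-determining⇒tail-period : ∀ ξ u i p → RightDetermining (F ξ) u →
  OccursAt ξ i u → OccursAt ξ (i + + p) u →
  ∀ n → i + + length u ℤ.≤ n → ξ n ≡ ξ (n + + p)
right-determining⇒tail-period ξ u i p (_ , determined) oᵢ oᵢ₊ₚ n after
  with ≤⇒offset after
... | s , refl = begin
  ξ ((i + + L) + + s)          ≡⟨ window-agree ξ _ _ (suc s) same s (ℕP.n<1+n s) ⟩
  ξ (((i + + p) + + L) + + s)  ≡⟨ cong ξ (regroup i (+ p) (+ L) (+ s)) ⟩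
  ξ (((i + + L) + + s) + + p)  ∎
  where
  open ≡-Reasoning
  L = length u
  extension : ∀ c → OccursAt ξ c u → F ξ (u ++ window ξ (c + + L) (suc s))
  extension c o = c , occurs-++ ξ c u _ o (window-occurs ξ (c + + L) (suc s))
  same : window ξ (i + + L) (suc s) ≡ window ξ ((i + + p) + + L) (suc s)
  same = exactly-one-unique (determined (suc s))
    (length-window ξ (i + + L) (suc s)) (extension i oᵢ)
    (length-window ξ ((i + + p) + + L) (suc s)) (extension (i + + p) oᵢ₊ₚ)
  regroup : ∀ i p L s → ((i + p) + L) + s ≡ ((i + L) + s) + p
  regroup = solve-∀

left-determining⇒head-period : ∀ ξ u i p → LeftDetermining (F ξ) u →
  OccursAt ξ i u → OccursAt ξ (i + + p) u →
  ∀ n → n ℤ.< i → ξ n ≡ ξ (n + + p)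
left-determining⇒head-period ξ u i p (_ , determined) oᵢ oᵢ₊ₚ n before
  with <⇒offset before
... | t , i≡ = begin
  ξ n                  ≡⟨ cong ξ (ℤP.+-identityʳ n) ⟨
  ξ (n + + 0)          ≡⟨ window-agree ξ _ _ k same 0 (s≤s z≤n) ⟩
  ξ ((n + + p) + + 0)  ≡⟨ cong ξ (ℤP.+-identityʳ (n + + p)) ⟩
  ξ (n + + p)          ∎
  where
  open ≡-Reasoning
  k = suc t
  extension : ∀ d → OccursAt ξ (d + + k) u → F ξ (window ξ d k ++ u)
  extension d o = d , occurs-++ ξ d (window ξ d k) u (window-occurs ξ d k)
    (occurs-subst ξ u (cong (λ m → d + + m) (sym (length-window ξ d k))) o)
  shifted : i + + p ≡ (n + + p) + + k
  shifted = trans (cong (_+ + p) i≡) (regroup n (+ k) (+ p))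
    where
    regroup : ∀ n k p → (n + k) + p ≡ (n + p) + k
    regroup = solve-∀
  same : window ξ n k ≡ window ξ (n + + p) k
  same = exactly-one-unique (determined k)
    (length-window ξ n k) (extension n (occurs-subst ξ u i≡ oᵢ))
    (length-window ξ (n + + p) k) (extension (n + + p) (occurs-subst ξ u shifted oᵢ₊ₚ))

recurs-later : ∀ ξ → Recurrent ξ → ∀ i u → OccursAt ξ i u →
  Σ ℕ λ q → OccursAt ξ (i + + suc q) u
recurs-later ξ rec i u o with proj₁ (proj₂ (rec (i + + 1))) u (i , o)
... | j , after-i , oⱼ with ≤⇒offset after-i
... | q , refl = q , occurs-subst ξ u (ℤP.+-assoc i (+ 1) (+ q)) oⱼ

-- (3) ⇒ (1): p is the gap to the next occurrence of u; the region is the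
-- right half starting after the first occurrence.
right-determining⇒periodic : ∀ ξ → Recurrent ξ →
  Σ (List Bool) (λ u → RightDetermining (F ξ) u) → Periodic ξ
right-determining⇒periodic ξ rec (u , determining@((i , oᵢ) , _))
  with recurs-later ξ rec i u oᵢ
... | q , oⱼ = suc q , s≤s z≤n ,
  region-period⇒period ξ (i + + length u ℤ.≤_) (suc q)
    (right-determining⇒tail-period ξ u i (suc q) determining oᵢ oⱼ)
    (λ n → proj₁ (proj₂ (rec (i + + length u))) _ (n , window-occurs ξ n _))

left-determining⇒periodic : ∀ ξ → Recurrent ξ →
  Σ (List Bool) (λ u → LeftDetermining (F ξ) u) → Periodic ξ
left-determining⇒periodic ξ rec (u , determining@((i , oᵢ) , _))
  with recurs-later ξ rec i u oᵢ
... | q , oⱼ = suc q , s≤s z≤n ,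
  region-period⇒period ξ (ℤ._< i) (suc q)
    (left-determining⇒head-period ξ u i (suc q) determining oᵢ oⱼ)
    reoccurs-before-i
  where
  -- Recurrence of the left half ending at i - 1 places every window before i.
  reoccurs-before-i : ∀ n →
    ∃ λ m → m ℤ.< i × OccursAt ξ m (window ξ n (suc (suc q)))
  reoccurs-before-i n with proj₁ (proj₁ (rec (i - + 1))) (window ξ n (suc (suc q)))
                            (n , window-occurs ξ n _)
  ... | m , ends-before , o = m , left-half-start m _ i ends-before , o

periodic⇒determining : ∀ ξ → Periodic ξ → Σ (List Bool) (λ u → Determining (F ξ) u)
periodic⇒determining ξ (suc q , _ , per) =
  window ξ (+ 0) (suc q) , period⇒determining ξ per (+ 0)

lemma5p6 : (ξ : BiWord) → Recurrent ξ →
    (Periodic ξ ⇔ Σ (List Bool) (λ u → Determining (F ξ) u))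
    × (Periodic ξ ⇔ Σ (List Bool) (λ u → RightDetermining (F ξ) u))
    × (Periodic ξ ⇔ Σ (List Bool) (λ u → LeftDetermining (F ξ) u))
lemma5p6 ξ rec =
    mk⇔ (periodic⇒determining ξ) (right-determining⇒periodic ξ rec ∘ map₂ proj₂)
  , mk⇔ (map₂ proj₂ ∘ periodic⇒determining ξ) (right-determining⇒periodic ξ rec)
  , mk⇔ (map₂ proj₁ ∘ periodic⇒determining ξ) (left-determining⇒periodic ξ rec)
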